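{- Let $\mathcal{L}\subset\mathbb{R}^d$ be a lattice of rank $n\ge2$ with basis $B\in\mathbb{R}^{d\times n}$, and let $\vec t\in\mathbb{R}^d$. Suppose that $\vec z_1,\vec z_2,\vec z_3,\vec z_4:=\vec z_1+\vec z_2+\vec z_3-2\vec v\in\mathrm{CVP}(\vec t,B)$ are coordinates of distinct closest lattice vectors, where $\vec v\in\mathbb{Z}^n$. Then $\vec z_1',\vec z_2',\vec z_3',\vec z_4'\in\mathrm{CVP}(\vec t,B)$, where \[ \vec z_1':=\vec z_2+\vec z_3-\vec v,\quad \vec z_2':=\vec z_1+\vec z_3-\vec v,\quad \vec z_3':=\vec z_1+\vec z_2-\vec v,\quad \vec z_4':=\vec v. \] In particular, $C:=\{\vec z_1,\vec z_2,\vec z_3,\vec z_4\}\cup\{\vec z_1',\vec z_2',\vec z_3',\vec z_4'\}$ has size either four or eight, and $|C|=4$ if and only if $C=\{\vec y_0,\vec y_0+\vec y_1,\vec y_0+\vec y_2,\vec y_0+\vec y_1+\vec y_2\}$ for some $\vec y_i\in\mathbb{Z}^n$, i.e., $C$ is a parallelogram.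
   Context: $\mathrm{CVP}(\vec t,B):=\{\vec z\in\mathbb{Z}^n:\|B\vec z-\vec t\|_2=\min_{\vec y\in\mathcal{L}}\|\vec y-\vec t\|_2\}$, the set of coefficient vectors of closest lattice vectors to $\vec t$ in the Euclidean norm. -}

module Defs where

open import Level using (Level; _⊔_; suc)
open import Algebra.Bundles using (CommutativeRing)
open import Relation.Binary.Structures using (IsTotalOrder)
open import Relation.Nullary using (¬_)
open import Data.Product using (Σ; ∃; _×_; _,_)
open import Data.Nat as ℕ using (ℕ)
open import Data.Integer as ℤ using (ℤ; +_; -[1+_])
open import Data.Vec using (Vec; []; _∷_; map; zipWith; foldr)
open import Data.Vec.Relation.Unary.All using (All)
open import Data.List using (List; length)
open import Data.List.Membership.Propositional using (_∈_)
open import Data.List.Relation.Unary.Unique.Propositional using (Unique)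
open import Relation.Binary.PropositionalEquality using (_≡_)

-- A complete ordered field (the real numbers are, up to isomorphism, the
-- unique such structure).  We state the theorem for an arbitrary one.
record CompleteOrderedField (c ℓ₁ ℓ₂ : Level) : Set (Level.suc (c ⊔ ℓ₁ ⊔ ℓ₂)) where
  field
    commutativeRing : CommutativeRing c ℓ₁
  open CommutativeRing commutativeRing public
  field
    _≤_           : Carrier → Carrier → Set ℓ₂
    isTotalOrder  : IsTotalOrder _≈_ _≤_
    +-mono-≤      : ∀ {x y} z → x ≤ y → (x + z) ≤ (y + z)
    *-nonneg      : ∀ {x y} → 0# ≤ x → 0# ≤ y → 0# ≤ (x * y)
    nontrivial    : ¬ (1# ≈ 0#)
    inverse       : ∀ x → ¬ (x ≈ 0#) → Σ Carrier λ y → (x * y) ≈ 1#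
    sup           : (P : Carrier → Set c) → Σ Carrier P →
                    Σ Carrier (λ b → ∀ x → P x → x ≤ b) →
                    Σ Carrier (λ s → (∀ x → P x → x ≤ s) ×
                                     (∀ b → (∀ x → P x → x ≤ b) → s ≤ b))

_⊕_ : ∀ {n} → Vec ℤ n → Vec ℤ n → Vec ℤ n
_⊕_ = zipWith ℤ._+_

_⊖_ : ∀ {n} → Vec ℤ n → Vec ℤ n → Vec ℤ n
_⊖_ = zipWith ℤ._-_

infixl 6 _⊕_ _⊖_

-- finite sets of coefficient vectors, given as lists
SameSet : ∀ {n} → List (Vec ℤ n) → List (Vec ℤ n) → Set
SameSet l C = ∀ x → (x ∈ l → x ∈ C) × (x ∈ C → x ∈ l)

HasSize : ∀ {n} → List (Vec ℤ n) → ℕ → Set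
HasSize {n} C k = Σ (List (Vec ℤ n)) λ l → Unique l × length l ≡ k × SameSet l C

module LatticeDefs {c ℓ₁ ℓ₂} (F : CompleteOrderedField c ℓ₁ ℓ₂) where
  open CompleteOrderedField F

  ℕ↑ : ℕ → Carrier
  ℕ↑ ℕ.zero    = 0#
  ℕ↑ (ℕ.suc m) = 1# + ℕ↑ m

  ℤ↑ : ℤ → Carrier
  ℤ↑ (+ m)      = ℕ↑ m
  ℤ↑ -[1+ m ]   = - (ℕ↑ (ℕ.suc m))

  dot : ∀ {n} → Vec Carrier n → Vec Carrier n → Carrier
  dot u w = foldr _ _+_ 0# (zipWith _*_ u w)

  -- B is a d×n matrix, stored as its d rows
  mulVec : ∀ {d n} → Vec (Vec Carrier n) d → Vec Carrier n → Vec Carrier d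
  mulVec B x = map (λ row → dot row x) B

  latticePt : ∀ {d n} → Vec (Vec Carrier n) d → Vec ℤ n → Vec Carrier d
  latticePt B z = mulVec B (map ℤ↑ z)

  distSq : ∀ {d} → Vec Carrier d → Vec Carrier d → Carrier
  distSq u w = let e = zipWith _-_ u w in dot e e

  -- columns of B are linearly independent over F (B is a basis of a rank-n lattice)
  LinIndepCols : ∀ {d n} → Vec (Vec Carrier n) d → Set (c ⊔ ℓ₁)
  LinIndepCols B = ∀ x → All (_≈ 0#) (mulVec B x) → All (_≈ 0#) x

  InCVP : ∀ {d n} → Vec Carrier d → Vec (Vec Carrier n) d → Vec ℤ n → Set ℓ₂
  InCVP t B z = ∀ y → distSq (latticePt B z) t ≤ distSq (latticePt B y) t

module Submission where

-- Proof of Lemma 6.8.  Write z₄ = z₁ + z₂ + z₃ − 2v and zᵢ′ for the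
-- reflected points of the statement, and D(z) = ‖Bz − t‖².
--
-- Coordinate by coordinate, the polynomial identity
--   Σᵢ (aᵢ′ − s)² = Σᵢ (aᵢ − s)²
-- (with aᵢ′ the reflected combinations of a₁ a₂ a₃ a₄) gives
-- Σᵢ D(zᵢ′) = Σᵢ D(zᵢ) = 4μ, where μ is the minimal distance.  As every
-- D(zᵢ′) ≥ μ, all of them equal μ: the zᵢ′ are closest vectors too.
-- Strict convexity (the parallelogram law D(r) + D(q) = 2D(p) + 2‖B(p−q)‖²
-- for r + q = 2p) shows that if q and 2p − q are closest vectors then
-- p = q, using linear independence of the columns; this forbids zᵢ = zᵢ′
-- and z₄ = v.
--
-- All eight points are ℤ-linear combinations of
-- z₁ z₂ z₃ v, so every coincidence between them is a linear relation.  If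
-- v ∈ {z₁, z₂, z₃}, C collapses to the parallelogram {z₁, z₂, z₃, z₄};
-- otherwise the ten known inequalities force all eight points to be
-- distinct, and a pigeonhole argument excludes size four.

open import Defs
open import Level using (Level)
open import Data.Nat as ℕ using (ℕ; _≤_; z≤n; s≤s)
open import Data.Integer as ℤ using (ℤ; +_; -[1+_])
import Data.Integer.Properties as ℤP
import Data.Nat.Properties as ℕP
open import Data.Maybe using (Maybe; just; nothing)
open import Algebra.Bundles using (CommutativeRing)
open import Relation.Binary.Structures using (IsTotalOrder)
open import Data.Integer.Tactic.RingSolver using (solve-∀)
open import Data.Vec using (Vec; []; _∷_; map)
import Data.Vec.Properties as VecP
open import Data.List using (List; []; _∷_; length)
import Data.List.Properties as ListP
open import Data.List.Relation.Unary.Any using (here; there; index; _─_)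
open import Data.List.Relation.Unary.All as All using (All; []; _∷_)
open import Data.Vec.Relation.Unary.All as VecAll using ([]; _∷_)
open import Data.List.Relation.Unary.AllPairs using ([]; _∷_)
open import Data.List.Relation.Unary.Unique.Propositional using (Unique)
open import Data.List.Membership.Propositional using (_∈_)
open import Data.List.Relation.Binary.Subset.Propositional using (_⊆_)
open import Data.Product using (Σ; _×_; _,_; proj₁; proj₂)
open import Data.Sum using (_⊎_; inj₁; inj₂)
open import Data.Empty using (⊥-elim)
open import Relation.Nullary using (¬_; yes; no)
open import Relation.Nullary.Decidable using (True; toWitness)
open import Relation.Binary.PropositionalEquality
  using (_≡_; _≢_; refl; sym; trans; cong; cong₂; subst; subst₂; ≢-sym)
open import Function.Bundles using (_⇔_; mk⇔)

-- If e₃ − e₄ and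
-- e₁ − e₂ have the same coefficients, then e₁ = e₂ entails e₃ = e₄ (in
-- particular e₃ = e₄ holds outright when e₃ − e₄ has zero coefficients),
-- because this holds in every coordinate.
module LinearIdentities where

  data Expr : Set where
    Z₁ Z₂ Z₃ V : Expr
    _⊞_ _⊟_   : Expr → Expr → Expr

  infixl 6 _⊞_ _⊟_

  ⟦_⟧ : Expr → ∀ {n} → Vec ℤ n → Vec ℤ n → Vec ℤ n → Vec ℤ n → Vec ℤ n
  ⟦ Z₁ ⟧    a b c d = a
  ⟦ Z₂ ⟧    a b c d = b
  ⟦ Z₃ ⟧    a b c d = c
  ⟦ V ⟧     a b c d = d
  ⟦ e ⊞ f ⟧ a b c d = ⟦ e ⟧ a b c d ⊕ ⟦ f ⟧ a b c d
  ⟦ e ⊟ f ⟧ a b c d = ⟦ e ⟧ a b c d ⊖ ⟦ f ⟧ a b c d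

  ⟦_⟧ˢ : Expr → ℤ → ℤ → ℤ → ℤ → ℤ
  ⟦ Z₁ ⟧ˢ    a b c d = a
  ⟦ Z₂ ⟧ˢ    a b c d = b
  ⟦ Z₃ ⟧ˢ    a b c d = c
  ⟦ V ⟧ˢ     a b c d = d
  ⟦ e ⊞ f ⟧ˢ a b c d = ⟦ e ⟧ˢ a b c d ℤ.+ ⟦ f ⟧ˢ a b c d
  ⟦ e ⊟ f ⟧ˢ a b c d = ⟦ e ⟧ˢ a b c d ℤ.- ⟦ f ⟧ˢ a b c d

  ⟦⟧-∷ : ∀ e {n} a b c d (as bs cs ds : Vec ℤ n) →
    ⟦ e ⟧ (a ∷ as) (b ∷ bs) (c ∷ cs) (d ∷ ds) ≡ ⟦ e ⟧ˢ a b c d ∷ ⟦ e ⟧ as bs cs ds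
  ⟦⟧-∷ Z₁ a b c d as bs cs ds = refl
  ⟦⟧-∷ Z₂ a b c d as bs cs ds = refl
  ⟦⟧-∷ Z₃ a b c d as bs cs ds = refl
  ⟦⟧-∷ V  a b c d as bs cs ds = refl
  ⟦⟧-∷ (e ⊞ f) a b c d as bs cs ds
    rewrite ⟦⟧-∷ e a b c d as bs cs ds | ⟦⟧-∷ f a b c d as bs cs ds = refl
  ⟦⟧-∷ (e ⊟ f) a b c d as bs cs ds
    rewrite ⟦⟧-∷ e a b c d as bs cs ds | ⟦⟧-∷ f a b c d as bs cs ds = refl

  coeffs : Expr → Vec ℤ 4
  coeffs Z₁      = + 1 ∷ + 0 ∷ + 0 ∷ + 0 ∷ []
  coeffs Z₂      = + 0 ∷ + 1 ∷ + 0 ∷ + 0 ∷ []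
  coeffs Z₃      = + 0 ∷ + 0 ∷ + 1 ∷ + 0 ∷ []
  coeffs V       = + 0 ∷ + 0 ∷ + 0 ∷ + 1 ∷ []
  coeffs (e ⊞ f) = coeffs e ⊕ coeffs f
  coeffs (e ⊟ f) = coeffs e ⊖ coeffs f

  combine : Vec ℤ 4 → ℤ → ℤ → ℤ → ℤ → ℤ
  combine (k₁ ∷ k₂ ∷ k₃ ∷ k₄ ∷ []) a b c d =
    k₁ ℤ.* a ℤ.+ k₂ ℤ.* b ℤ.+ k₃ ℤ.* c ℤ.+ k₄ ℤ.* d

  combine-⊕ : ∀ k l a b c d → combine (k ⊕ l) a b c d ≡ combine k a b c d ℤ.+ combine l a b c d
  combine-⊕ (k₁ ∷ k₂ ∷ k₃ ∷ k₄ ∷ []) (l₁ ∷ l₂ ∷ l₃ ∷ l₄ ∷ []) = distrib k₁ k₂ k₃ k₄ l₁ l₂ l₃ l₄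
    where
    distrib : ∀ k₁ k₂ k₃ k₄ l₁ l₂ l₃ l₄ a b c d →
      (k₁ ℤ.+ l₁) ℤ.* a ℤ.+ (k₂ ℤ.+ l₂) ℤ.* b ℤ.+ (k₃ ℤ.+ l₃) ℤ.* c ℤ.+ (k₄ ℤ.+ l₄) ℤ.* d
      ≡ (k₁ ℤ.* a ℤ.+ k₂ ℤ.* b ℤ.+ k₃ ℤ.* c ℤ.+ k₄ ℤ.* d)
        ℤ.+ (l₁ ℤ.* a ℤ.+ l₂ ℤ.* b ℤ.+ l₃ ℤ.* c ℤ.+ l₄ ℤ.* d)
    distrib = solve-∀

  combine-⊖ : ∀ k l a b c d → combine (k ⊖ l) a b c d ≡ combine k a b c d ℤ.- combine l a b c d
  combine-⊖ (k₁ ∷ k₂ ∷ k₃ ∷ k₄ ∷ []) (l₁ ∷ l₂ ∷ l₃ ∷ l₄ ∷ []) = distrib k₁ k₂ k₃ k₄ l₁ l₂ l₃ l₄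
    where
    distrib : ∀ k₁ k₂ k₃ k₄ l₁ l₂ l₃ l₄ a b c d →
      (k₁ ℤ.- l₁) ℤ.* a ℤ.+ (k₂ ℤ.- l₂) ℤ.* b ℤ.+ (k₃ ℤ.- l₃) ℤ.* c ℤ.+ (k₄ ℤ.- l₄) ℤ.* d
      ≡ (k₁ ℤ.* a ℤ.+ k₂ ℤ.* b ℤ.+ k₃ ℤ.* c ℤ.+ k₄ ℤ.* d)
        ℤ.- (l₁ ℤ.* a ℤ.+ l₂ ℤ.* b ℤ.+ l₃ ℤ.* c ℤ.+ l₄ ℤ.* d)
    distrib = solve-∀

  ⟦⟧ˢ-coeffs : ∀ e a b c d → ⟦ e ⟧ˢ a b c d ≡ combine (coeffs e) a b c d
  ⟦⟧ˢ-coeffs Z₁ = basis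
    where basis : ∀ a b c d → a ≡ + 1 ℤ.* a ℤ.+ + 0 ℤ.* b ℤ.+ + 0 ℤ.* c ℤ.+ + 0 ℤ.* d
          basis = solve-∀
  ⟦⟧ˢ-coeffs Z₂ = basis
    where basis : ∀ a b c d → b ≡ + 0 ℤ.* a ℤ.+ + 1 ℤ.* b ℤ.+ + 0 ℤ.* c ℤ.+ + 0 ℤ.* d
          basis = solve-∀
  ⟦⟧ˢ-coeffs Z₃ = basis
    where basis : ∀ a b c d → c ≡ + 0 ℤ.* a ℤ.+ + 0 ℤ.* b ℤ.+ + 1 ℤ.* c ℤ.+ + 0 ℤ.* d
          basis = solve-∀
  ⟦⟧ˢ-coeffs V = basis
    where basis : ∀ a b c d → d ≡ + 0 ℤ.* a ℤ.+ + 0 ℤ.* b ℤ.+ + 0 ℤ.* c ℤ.+ + 1 ℤ.* d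
          basis = solve-∀
  ⟦⟧ˢ-coeffs (e ⊞ f) a b c d =
    trans (cong₂ ℤ._+_ (⟦⟧ˢ-coeffs e a b c d) (⟦⟧ˢ-coeffs f a b c d))
          (sym (combine-⊕ (coeffs e) (coeffs f) a b c d))
  ⟦⟧ˢ-coeffs (e ⊟ f) a b c d =
    trans (cong₂ ℤ._-_ (⟦⟧ˢ-coeffs e a b c d) (⟦⟧ˢ-coeffs f a b c d))
          (sym (combine-⊖ (coeffs e) (coeffs f) a b c d))

  transferˢ : ∀ e₁ e₂ e₃ e₄ → coeffs (e₃ ⊟ e₄) ≡ coeffs (e₁ ⊟ e₂) → ∀ a b c d →
    ⟦ e₁ ⟧ˢ a b c d ≡ ⟦ e₂ ⟧ˢ a b c d → ⟦ e₃ ⟧ˢ a b c d ≡ ⟦ e₄ ⟧ˢ a b c d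
  transferˢ e₁ e₂ e₃ e₄ same a b c d e₁≡e₂ = ℤP.i-j≡0⇒i≡j _ _ (begin
    ⟦ e₃ ⊟ e₄ ⟧ˢ a b c d             ≡⟨ ⟦⟧ˢ-coeffs (e₃ ⊟ e₄) a b c d ⟩
    combine (coeffs (e₃ ⊟ e₄)) a b c d ≡⟨ cong (λ k → combine k a b c d) same ⟩
    combine (coeffs (e₁ ⊟ e₂)) a b c d ≡⟨ sym (⟦⟧ˢ-coeffs (e₁ ⊟ e₂) a b c d) ⟩
    ⟦ e₁ ⊟ e₂ ⟧ˢ a b c d             ≡⟨ ℤP.i≡j⇒i-j≡0 e₁≡e₂ ⟩
    + 0                              ∎)
    where open Relation.Binary.PropositionalEquality.≡-Reasoning

  transferⁿ : ∀ e₁ e₂ e₃ e₄ → coeffs (e₃ ⊟ e₄) ≡ coeffs (e₁ ⊟ e₂) →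
    ∀ {n} (a b c d : Vec ℤ n) → ⟦ e₁ ⟧ a b c d ≡ ⟦ e₂ ⟧ a b c d → ⟦ e₃ ⟧ a b c d ≡ ⟦ e₄ ⟧ a b c d
  transferⁿ e₁ e₂ e₃ e₄ same [] [] [] [] _ = empty-unique _ _
    where
    empty-unique : (xs ys : Vec ℤ 0) → xs ≡ ys
    empty-unique [] [] = refl
  transferⁿ e₁ e₂ e₃ e₄ same (a ∷ as) (b ∷ bs) (c ∷ cs) (d ∷ ds) e₁≡e₂ =
    trans (⟦⟧-∷ e₃ a b c d as bs cs ds)
      (trans (cong₂ _∷_ (transferˢ e₁ e₂ e₃ e₄ same a b c d (VecP.∷-injectiveˡ e₁≡e₂′))
                        (transferⁿ e₁ e₂ e₃ e₄ same as bs cs ds (VecP.∷-injectiveʳ e₁≡e₂′)))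
             (sym (⟦⟧-∷ e₄ a b c d as bs cs ds)))
    where
    e₁≡e₂′ : ⟦ e₁ ⟧ˢ a b c d ∷ ⟦ e₁ ⟧ as bs cs ds ≡ ⟦ e₂ ⟧ˢ a b c d ∷ ⟦ e₂ ⟧ as bs cs ds
    e₁≡e₂′ = trans (sym (⟦⟧-∷ e₁ a b c d as bs cs ds)) (trans e₁≡e₂ (⟦⟧-∷ e₂ a b c d as bs cs ds))

module FiniteSets {A : Set} where

  ∈-─ : ∀ {x y : A} ys (x∈ys : x ∈ ys) → y ∈ ys → x ≢ y → y ∈ (ys ─ x∈ys)
  ∈-─ (_ ∷ _)  (here refl)  (here refl) x≢y = ⊥-elim (x≢y refl)
  ∈-─ (_ ∷ _)  (here refl)  (there y∈)  x≢y = y∈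
  ∈-─ (_ ∷ _)  (there x∈)   (here refl) x≢y = here refl
  ∈-─ (_ ∷ ys) (there x∈)   (there y∈)  x≢y = there (∈-─ ys x∈ y∈ x≢y)

  unique-⊆⇒length≤ : ∀ {xs ys : List A} → Unique xs → xs ⊆ ys → length xs ≤ length ys
  unique-⊆⇒length≤ {[]}     _              _   = z≤n
  unique-⊆⇒length≤ {x ∷ xs} {ys} (x∉xs ∷ u) xs⊆ys =
    subst (ℕ.suc (length xs) ≤_) (sym (ListP.length-removeAt′ ys (index x∈ys)))
      (s≤s (unique-⊆⇒length≤ u λ y∈xs →
        ∈-─ ys x∈ys (xs⊆ys (there y∈xs)) (All.lookup x∉xs y∈xs)))
    where
    x∈ys : x ∈ ys
    x∈ys = xs⊆ys (here refl)

module Sizes {n : ℕ} where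
  open LinearIdentities using (Z₁; Z₂; Z₃; V; _⊞_; _⊟_; transferⁿ)
  open FiniteSets using (unique-⊆⇒length≤)

  IsParallelogram : List (Vec ℤ n) → Set
  IsParallelogram C = Σ (Vec ℤ n) λ y₀ → Σ (Vec ℤ n) λ y₁ → Σ (Vec ℤ n) λ y₂ →
    SameSet C (y₀ ∷ y₀ ⊕ y₁ ∷ y₀ ⊕ y₂ ∷ y₀ ⊕ y₁ ⊕ y₂ ∷ [])

  SizeClaim : List (Vec ℤ n) → Set
  SizeClaim C = (HasSize C 4 ⊎ HasSize C 8) × (HasSize C 4 ⇔ IsParallelogram C)

  pattern at₁ e = here e
  pattern at₂ e = there (here e)
  pattern at₃ e = there (there (here e))
  pattern at₄ e = there (there (there (here e)))

  sameSet : ∀ {l C : List (Vec ℤ n)} → All (_∈ C) l → All (_∈ l) C → SameSet l C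
  sameSet l⊆C C⊆l x = All.lookup l⊆C , All.lookup C⊆l

  distinct₄ : ∀ {a b c d : Vec ℤ n} → a ≢ b → a ≢ c → a ≢ d → b ≢ c → b ≢ d → c ≢ d →
    Unique (a ∷ b ∷ c ∷ d ∷ [])
  distinct₄ a≢b a≢c a≢d b≢c b≢d c≢d =
    (a≢b ∷ a≢c ∷ a≢d ∷ []) ∷ (b≢c ∷ b≢d ∷ []) ∷ (c≢d ∷ []) ∷ [] ∷ []

  parallelogram : ∀ {C} (p q r s : Vec ℤ n) → Unique (p ∷ q ∷ r ∷ s ∷ []) →
    SameSet (p ∷ q ∷ r ∷ s ∷ []) C → q ⊕ r ≡ p ⊕ s → SizeClaim C
  parallelogram {C} p q r s distinct same diagonals =
    inj₁ size , mk⇔ (λ _ → spanned) (λ _ → size)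
    where
    size : HasSize C 4
    size = _ , distinct , refl , same
    to-q : p ⊕ (q ⊖ p) ≡ q
    to-q = transferⁿ Z₁ Z₁ (Z₁ ⊞ (Z₂ ⊟ Z₁)) Z₂ refl p q r s refl
    to-r : p ⊕ (r ⊖ p) ≡ r
    to-r = transferⁿ Z₁ Z₁ (Z₁ ⊞ (Z₃ ⊟ Z₁)) Z₃ refl p q r s refl
    to-s : p ⊕ (q ⊖ p) ⊕ (r ⊖ p) ≡ s
    to-s = transferⁿ (Z₂ ⊞ Z₃) (Z₁ ⊞ V) (Z₁ ⊞ (Z₂ ⊟ Z₁) ⊞ (Z₃ ⊟ Z₁)) V refl p q r s diagonals
    spanned : IsParallelogram C
    spanned = p , q ⊖ p , r ⊖ p , reversed
      where
      reversed : SameSet C (p ∷ p ⊕ (q ⊖ p) ∷ p ⊕ (r ⊖ p) ∷ p ⊕ (q ⊖ p) ⊕ (r ⊖ p) ∷ [])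
      reversed rewrite to-s | to-q | to-r = λ x → proj₂ (same x) , proj₁ (same x)

  eight-distinct : ∀ {C : List (Vec ℤ n)} → Unique C → length C ≡ 8 → SizeClaim C
  eight-distinct {C} distinct |C|≡8 =
    inj₂ (C , distinct , |C|≡8 , λ x → (λ x∈C → x∈C) , (λ x∈C → x∈C)) , mk⇔
      (λ { (l , _ , |l|≡4 , same) → ⊥-elim (8≰4 (subst₂ ℕ._≤_ |C|≡8 |l|≡4
                                      (unique-⊆⇒length≤ distinct (proj₂ (same _))))) })
      (λ { (_ , _ , _ , same) → ⊥-elim (8≰4 (subst (ℕ._≤ 4) |C|≡8
                                      (unique-⊆⇒length≤ distinct (proj₁ (same _))))) })
    where
    8≰4 : ¬ (8 ≤ 4)
    8≰4 (s≤s (s≤s (s≤s (s≤s ()))))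

module Configuration {n : ℕ} (z₁ z₂ z₃ v : Vec ℤ n) where
  open LinearIdentities
  open Sizes

  Z₄ Z₁′ Z₂′ Z₃′ : Expr
  Z₄  = Z₁ ⊞ Z₂ ⊞ Z₃ ⊟ (V ⊞ V)
  Z₁′ = Z₂ ⊞ Z₃ ⊟ V
  Z₂′ = Z₁ ⊞ Z₃ ⊟ V
  Z₃′ = Z₁ ⊞ Z₂ ⊟ V

  pt : Expr → Vec ℤ n
  pt e = ⟦ e ⟧ z₁ z₂ z₃ v

  C : List (Vec ℤ n)
  C = pt Z₁ ∷ pt Z₂ ∷ pt Z₃ ∷ pt Z₄ ∷ pt Z₁′ ∷ pt Z₂′ ∷ pt Z₃′ ∷ pt V ∷ []

  transfer : ∀ e₁ e₂ e₃ e₄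
    {_ : True (VecP.≡-dec ℤ._≟_ (coeffs (e₃ ⊟ e₄)) (coeffs (e₁ ⊟ e₂)))} →
    pt e₁ ≡ pt e₂ → pt e₃ ≡ pt e₄
  transfer e₁ e₂ e₃ e₄ {same} = transferⁿ e₁ e₂ e₃ e₄ (toWitness same) z₁ z₂ z₃ v

  ≢-transfer : ∀ e₁ e₂ e₃ e₄
    {_ : True (VecP.≡-dec ℤ._≟_ (coeffs (e₃ ⊟ e₄)) (coeffs (e₁ ⊟ e₂)))} →
    pt e₁ ≢ pt e₂ → pt e₃ ≢ pt e₄
  ≢-transfer e₁ e₂ e₃ e₄ {same} e₁≢e₂ e₃≡e₄ =
    e₁≢e₂ (transferⁿ e₃ e₄ e₁ e₂ (sym (toWitness same)) z₁ z₂ z₃ v e₃≡e₄)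

  -- If v = zₖ, the points z₁′ z₂′ z₃′ v repeat z₁ z₂ z₃ z₄, and with
  -- p = zₖ and s = z₄ these form a parallelogram.
  collapsed-at-z₁ : v ≡ z₁ → Unique (z₁ ∷ z₂ ∷ z₃ ∷ pt Z₄ ∷ []) → SizeClaim C
  collapsed-at-z₁ v≡z₁ distinct = parallelogram z₁ z₂ z₃ (pt Z₄) distinct
    (sameSet (at₁ refl ∷ at₂ refl ∷ at₃ refl ∷ at₄ refl ∷ [])
             (at₁ refl ∷ at₂ refl ∷ at₃ refl ∷ at₄ refl
              ∷ at₄ (transfer V Z₁ Z₁′ Z₄ v≡z₁) ∷ at₃ (transfer Z₁ V Z₂′ Z₃ (sym v≡z₁))
              ∷ at₂ (transfer Z₁ V Z₃′ Z₂ (sym v≡z₁)) ∷ at₁ v≡z₁ ∷ []))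
    (transfer (V ⊞ V) (Z₁ ⊞ Z₁) (Z₂ ⊞ Z₃) (Z₁ ⊞ Z₄) (cong₂ _⊕_ v≡z₁ v≡z₁))

  collapsed-at-z₂ : v ≡ z₂ → Unique (z₂ ∷ z₁ ∷ z₃ ∷ pt Z₄ ∷ []) → SizeClaim C
  collapsed-at-z₂ v≡z₂ distinct = parallelogram z₂ z₁ z₃ (pt Z₄) distinct
    (sameSet (at₂ refl ∷ at₁ refl ∷ at₃ refl ∷ at₄ refl ∷ [])
             (at₂ refl ∷ at₁ refl ∷ at₃ refl ∷ at₄ refl
              ∷ at₃ (transfer Z₂ V Z₁′ Z₃ (sym v≡z₂)) ∷ at₄ (transfer V Z₂ Z₂′ Z₄ v≡z₂)
              ∷ at₂ (transfer Z₂ V Z₃′ Z₁ (sym v≡z₂)) ∷ at₁ v≡z₂ ∷ []))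
    (transfer (V ⊞ V) (Z₂ ⊞ Z₂) (Z₁ ⊞ Z₃) (Z₂ ⊞ Z₄) (cong₂ _⊕_ v≡z₂ v≡z₂))

  collapsed-at-z₃ : v ≡ z₃ → Unique (z₃ ∷ z₁ ∷ z₂ ∷ pt Z₄ ∷ []) → SizeClaim C
  collapsed-at-z₃ v≡z₃ distinct = parallelogram z₃ z₁ z₂ (pt Z₄) distinct
    (sameSet (at₃ refl ∷ at₁ refl ∷ at₂ refl ∷ at₄ refl ∷ [])
             (at₂ refl ∷ at₃ refl ∷ at₁ refl ∷ at₄ refl
              ∷ at₃ (transfer Z₃ V Z₁′ Z₂ (sym v≡z₃)) ∷ at₂ (transfer Z₃ V Z₂′ Z₁ (sym v≡z₃))
              ∷ at₄ (transfer V Z₃ Z₃′ Z₄ v≡z₃) ∷ at₁ v≡z₃ ∷ []))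
    (transfer (V ⊞ V) (Z₃ ⊞ Z₃) (Z₁ ⊞ Z₂) (Z₃ ⊞ Z₄) (cong₂ _⊕_ v≡z₃ v≡z₃))

  -- If v ∉ {z₁, z₂, z₃}, all eight points are distinct: each coincidence
  -- would be a linear relation already excluded.
  all-distinct : v ≢ z₁ → v ≢ z₂ → v ≢ z₃ →
    z₁ ≢ z₂ → z₁ ≢ z₃ → z₁ ≢ pt Z₄ → z₂ ≢ z₃ → z₂ ≢ pt Z₄ → z₃ ≢ pt Z₄ →
    z₁ ≢ pt Z₁′ → z₂ ≢ pt Z₂′ → z₃ ≢ pt Z₃′ → pt Z₄ ≢ v → Unique C
  all-distinct v≢z₁ v≢z₂ v≢z₃ z₁≢z₂ z₁≢z₃ z₁≢z₄ z₂≢z₃ z₂≢z₄ z₃≢z₄ z₁≢z₁′ z₂≢z₂′ z₃≢z₃′ z₄≢v =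
      (z₁≢z₂ ∷ z₁≢z₃ ∷ z₁≢z₄ ∷ z₁≢z₁′ ∷ ≢-transfer V Z₃ Z₁ Z₂′ v≢z₃
        ∷ ≢-transfer V Z₂ Z₁ Z₃′ v≢z₂ ∷ ≢-sym v≢z₁ ∷ [])
    ∷ (z₂≢z₃ ∷ z₂≢z₄ ∷ ≢-transfer V Z₃ Z₂ Z₁′ v≢z₃ ∷ z₂≢z₂′
        ∷ ≢-transfer V Z₁ Z₂ Z₃′ v≢z₁ ∷ ≢-sym v≢z₂ ∷ [])
    ∷ (z₃≢z₄ ∷ ≢-transfer V Z₂ Z₃ Z₁′ v≢z₂ ∷ ≢-transfer V Z₁ Z₃ Z₂′ v≢z₁
        ∷ z₃≢z₃′ ∷ ≢-sym v≢z₃ ∷ [])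
    ∷ (≢-transfer Z₁ V Z₄ Z₁′ (≢-sym v≢z₁) ∷ ≢-transfer Z₂ V Z₄ Z₂′ (≢-sym v≢z₂)
        ∷ ≢-transfer Z₃ V Z₄ Z₃′ (≢-sym v≢z₃) ∷ z₄≢v ∷ [])
    ∷ (≢-transfer Z₂ Z₁ Z₁′ Z₂′ (≢-sym z₁≢z₂) ∷ ≢-transfer Z₃ Z₁ Z₁′ Z₃′ (≢-sym z₁≢z₃)
        ∷ ≢-transfer Z₄ Z₁ Z₁′ V (≢-sym z₁≢z₄) ∷ [])
    ∷ (≢-transfer Z₃ Z₂ Z₂′ Z₃′ (≢-sym z₂≢z₃) ∷ ≢-transfer Z₄ Z₂ Z₂′ V (≢-sym z₂≢z₄) ∷ [])
    ∷ (≢-transfer Z₄ Z₃ Z₃′ V (≢-sym z₃≢z₄) ∷ [])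
    ∷ [] ∷ []

  size-of-C : z₁ ≢ z₂ → z₁ ≢ z₃ → z₁ ≢ pt Z₄ → z₂ ≢ z₃ → z₂ ≢ pt Z₄ → z₃ ≢ pt Z₄ →
    z₁ ≢ pt Z₁′ → z₂ ≢ pt Z₂′ → z₃ ≢ pt Z₃′ → pt Z₄ ≢ v → SizeClaim C
  size-of-C z₁≢z₂ z₁≢z₃ z₁≢z₄ z₂≢z₃ z₂≢z₄ z₃≢z₄ z₁≢z₁′ z₂≢z₂′ z₃≢z₃′ z₄≢v
    with VecP.≡-dec ℤ._≟_ v z₁ | VecP.≡-dec ℤ._≟_ v z₂ | VecP.≡-dec ℤ._≟_ v z₃
  ... | yes v≡z₁ | _ | _ = collapsed-at-z₁ v≡z₁
          (distinct₄ z₁≢z₂ z₁≢z₃ z₁≢z₄ z₂≢z₃ z₂≢z₄ z₃≢z₄)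
  ... | no _ | yes v≡z₂ | _ = collapsed-at-z₂ v≡z₂
          (distinct₄ (≢-sym z₁≢z₂) z₂≢z₃ z₂≢z₄ z₁≢z₃ z₁≢z₄ z₃≢z₄)
  ... | no _ | no _ | yes v≡z₃ = collapsed-at-z₃ v≡z₃
          (distinct₄ (≢-sym z₁≢z₃) (≢-sym z₂≢z₃) z₃≢z₄ z₁≢z₂ z₁≢z₄ z₂≢z₄)
  ... | no v≢z₁ | no v≢z₂ | no v≢z₃ = eight-distinct
          (all-distinct v≢z₁ v≢z₂ v≢z₃ z₁≢z₂ z₁≢z₃ z₁≢z₄ z₂≢z₃ z₂≢z₄ z₃≢z₄ z₁≢z₁′ z₂≢z₂′ z₃≢z₃′ z₄≢v)
          refl

-- The geometric part, over an arbitrary complete ordered field F (only the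
-- ordered-field axioms are used).
module Geometry {c ℓ₁ ℓ₂} (F : CompleteOrderedField c ℓ₁ ℓ₂) where
  open CompleteOrderedField F
    renaming (_≤_ to _≤F_; refl to ≈-refl; sym to ≈-sym; trans to ≈-trans)
  open LatticeDefs F
  open import Algebra.Properties.Ring ring using (-‿distribˡ-*)
  open import Algebra.Properties.AbelianGroup +-abelianGroup
    using (⁻¹-∙-comm; ⁻¹-involutive; ε⁻¹≈ε)
  module O = IsTotalOrder isTotalOrder

  infix 4 _≤ᶠ_
  _≤ᶠ_ : Carrier → Carrier → Set ℓ₂
  x ≤ᶠ y = x ≤F y

  module _ where
    open import Relation.Binary.Reasoning.Setoid setoid

    ℕ↑-+ : ∀ m k → ℕ↑ (m ℕ.+ k) ≈ ℕ↑ m + ℕ↑ k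
    ℕ↑-+ ℕ.zero    k = ≈-sym (+-identityˡ _)
    ℕ↑-+ (ℕ.suc m) k = ≈-trans (+-congˡ (ℕ↑-+ m k)) (≈-sym (+-assoc _ _ _))

    ℤ↑-natDiff : ∀ m k → ℤ↑ (m ℤ.⊖ k) ≈ ℕ↑ m - ℕ↑ k
    ℤ↑-natDiff m ℕ.zero = begin
      ℕ↑ m          ≈⟨ +-identityʳ _ ⟨
      ℕ↑ m + 0#     ≈⟨ +-congˡ ε⁻¹≈ε ⟨
      ℕ↑ m + - 0#   ∎
    ℤ↑-natDiff ℕ.zero (ℕ.suc k) = ≈-sym (+-identityˡ _)
    ℤ↑-natDiff (ℕ.suc m) (ℕ.suc k) = begin
      ℤ↑ (ℕ.suc m ℤ.⊖ ℕ.suc k)           ≡⟨ cong ℤ↑ (ℤP.[1+m]⊖[1+n]≡m⊖n m k) ⟩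
      ℤ↑ (m ℤ.⊖ k)                       ≈⟨ ℤ↑-natDiff m k ⟩
      ℕ↑ m - ℕ↑ k                        ≈⟨ shift 1# (ℕ↑ m) (ℕ↑ k) ⟩
      (1# + ℕ↑ m) + (- 1# + - ℕ↑ k)      ≈⟨ +-congˡ (⁻¹-∙-comm _ _) ⟩
      (1# + ℕ↑ m) - (1# + ℕ↑ k)          ∎
      where
      shift : ∀ a x y → x - y ≈ (a + x) + (- a + - y)
      shift a x y = begin
        x - y                    ≈⟨ +-identityˡ _ ⟨
        0# + (x - y)             ≈⟨ +-congʳ (-‿inverseʳ a) ⟨
        (a - a) + (x - y)        ≈⟨ +-assoc _ _ _ ⟩
        a + (- a + (x - y))      ≈⟨ +-congˡ (+-assoc _ _ _) ⟨
        a + ((- a + x) - y)      ≈⟨ +-congˡ (+-congʳ (+-comm _ _)) ⟩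
        a + ((x - a) - y)        ≈⟨ +-congˡ (+-assoc _ _ _) ⟩
        a + (x + (- a + - y))    ≈⟨ +-assoc _ _ _ ⟨
        (a + x) + (- a + - y)    ∎

    ℤ↑-+ : ∀ i j → ℤ↑ (i ℤ.+ j) ≈ ℤ↑ i + ℤ↑ j
    ℤ↑-+ (+ m)    (+ k)    = ℕ↑-+ m k
    ℤ↑-+ (+ m)    -[1+ k ] = ℤ↑-natDiff m (ℕ.suc k)
    ℤ↑-+ -[1+ m ] (+ k)    = ≈-trans (ℤ↑-natDiff k (ℕ.suc m)) (+-comm _ _)
    ℤ↑-+ -[1+ m ] -[1+ k ] = begin
      - ℕ↑ (ℕ.suc (ℕ.suc (m ℕ.+ k)))      ≡⟨ cong (λ i → - ℕ↑ i) (sym (ℕP.+-suc (ℕ.suc m) k)) ⟩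
      - ℕ↑ (ℕ.suc m ℕ.+ ℕ.suc k)          ≈⟨ -‿cong (ℕ↑-+ (ℕ.suc m) (ℕ.suc k)) ⟩
      - (ℕ↑ (ℕ.suc m) + ℕ↑ (ℕ.suc k))     ≈⟨ ⁻¹-∙-comm _ _ ⟨
      - ℕ↑ (ℕ.suc m) + - ℕ↑ (ℕ.suc k)     ∎

    ℤ↑-neg : ∀ i → ℤ↑ (ℤ.- i) ≈ - ℤ↑ i
    ℤ↑-neg -[1+ m ]       = ≈-sym (⁻¹-involutive _)
    ℤ↑-neg (+ ℕ.zero)     = ≈-sym ε⁻¹≈ε
    ℤ↑-neg (+ ℕ.suc m)    = ≈-refl

    ℤ↑-nat* : ∀ m j → ℤ↑ (+ m ℤ.* j) ≈ ℕ↑ m * ℤ↑ j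
    ℤ↑-nat* ℕ.zero    j = ≈-sym (zeroˡ _)
    ℤ↑-nat* (ℕ.suc m) j = begin
      ℤ↑ (+ ℕ.suc m ℤ.* j)        ≡⟨ cong ℤ↑ (trans (ℤP.*-distribʳ-+ j (+ 1) (+ m))
                                                    (cong (ℤ._+ (+ m ℤ.* j)) (ℤP.*-identityˡ j))) ⟩
      ℤ↑ (j ℤ.+ + m ℤ.* j)        ≈⟨ ℤ↑-+ j (+ m ℤ.* j) ⟩
      ℤ↑ j + ℤ↑ (+ m ℤ.* j)       ≈⟨ +-cong (≈-sym (*-identityˡ _)) (ℤ↑-nat* m j) ⟩
      1# * ℤ↑ j + ℕ↑ m * ℤ↑ j     ≈⟨ distribʳ _ _ _ ⟨
      (1# + ℕ↑ m) * ℤ↑ j          ∎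

    ℤ↑-* : ∀ i j → ℤ↑ (i ℤ.* j) ≈ ℤ↑ i * ℤ↑ j
    ℤ↑-* (+ m)    j = ℤ↑-nat* m j
    ℤ↑-* -[1+ m ] j = begin
      ℤ↑ (-[1+ m ] ℤ.* j)             ≡⟨ cong ℤ↑ (ℤP.neg-distribˡ-* (+ ℕ.suc m) j) ⟨
      ℤ↑ (ℤ.- (+ ℕ.suc m ℤ.* j))      ≈⟨ ℤ↑-neg (+ ℕ.suc m ℤ.* j) ⟩
      - ℤ↑ (+ ℕ.suc m ℤ.* j)          ≈⟨ -‿cong (ℤ↑-nat* (ℕ.suc m) j) ⟩
      - (ℕ↑ (ℕ.suc m) * ℤ↑ j)         ≈⟨ -‿distribˡ-* _ _ ⟩
      - ℕ↑ (ℕ.suc m) * ℤ↑ j           ∎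

    ℤ↑-- : ∀ i j → ℤ↑ (i ℤ.- j) ≈ ℤ↑ i - ℤ↑ j
    ℤ↑-- i j = ≈-trans (ℤ↑-+ i (ℤ.- j)) (+-congˡ (ℤ↑-neg j))

  open import Algebra.Solver.Ring.AlmostCommutativeRing
    using (fromCommutativeRing; _-Raw-AlmostCommutative⟶_)

  ℤ↑-homomorphism : CommutativeRing.rawRing ℤP.+-*-commutativeRing
                      -Raw-AlmostCommutative⟶ fromCommutativeRing commutativeRing
  ℤ↑-homomorphism = record
    { ⟦_⟧ = ℤ↑ ; +-homo = ℤ↑-+ ; *-homo = ℤ↑-* ; -‿homo = ℤ↑-neg
    ; 0-homo = ≈-refl ; 1-homo = +-identityʳ _ }

  ℤ↑-≟ : ∀ i j → Maybe (ℤ↑ i ≈ ℤ↑ j)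
  ℤ↑-≟ i j with i ℤ.≟ j
  ... | yes refl = just ≈-refl
  ... | no _     = nothing

  open import Algebra.Solver.Ring (CommutativeRing.rawRing ℤP.+-*-commutativeRing)
    (fromCommutativeRing commutativeRing) ℤ↑-homomorphism ℤ↑-≟
    using (solve; _:=_; _:+_; _:*_; _:-_; :-_)

  +-monoʳ-≤ : ∀ z {x y} → x ≤ᶠ y → z + x ≤ᶠ z + y
  +-monoʳ-≤ z {x} {y} x≤y =
    O.≤-respˡ-≈ (+-comm x z) (O.≤-respʳ-≈ (+-comm y z) (+-mono-≤ z x≤y))

  +-mono₂-≤ : ∀ {x y u w} → x ≤ᶠ y → u ≤ᶠ w → x + u ≤ᶠ y + w
  +-mono₂-≤ {y = y} {u} x≤y u≤w = O.trans (+-mono-≤ u x≤y) (+-monoʳ-≤ y u≤w)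

  +-cancelʳ-≤ : ∀ z {x y} → x + z ≤ᶠ y + z → x ≤ᶠ y
  +-cancelʳ-≤ z {x} {y} x+z≤y+z =
    O.≤-respˡ-≈ (cancel x) (O.≤-respʳ-≈ (cancel y) (+-mono-≤ (- z) x+z≤y+z))
    where
    cancel : ∀ a → a + z - z ≈ a
    cancel a = solve 2 (λ a z → a :+ z :- z := a) ≈-refl a z

  +-cancelˡ-≤ : ∀ z {x y} → z + x ≤ᶠ z + y → x ≤ᶠ y
  +-cancelˡ-≤ z {x} {y} z+x≤z+y =
    +-cancelʳ-≤ z (O.≤-respˡ-≈ (+-comm z x) (O.≤-respʳ-≈ (+-comm z y) z+x≤z+y))

  x≤x+y : ∀ {x y} → 0# ≤ᶠ y → x ≤ᶠ x + y
  x≤x+y {x} 0≤y = O.≤-respˡ-≈ (+-identityʳ x) (+-monoʳ-≤ x 0≤y)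

  square-nonneg : ∀ x → 0# ≤ᶠ x * x
  square-nonneg x with O.total 0# x
  ... | inj₁ 0≤x = *-nonneg 0≤x 0≤x
  ... | inj₂ x≤0 = O.≤-respʳ-≈ (solve 1 (λ x → :- x :* :- x := x :* x) ≈-refl x)
                     (*-nonneg 0≤-x 0≤-x)
    where
    0≤-x : 0# ≤ᶠ - x
    0≤-x = O.≤-respˡ-≈ (-‿inverseʳ x) (O.≤-respʳ-≈ (+-identityˡ _) (+-mono-≤ (- x) x≤0))

  sum-nonneg : ∀ {x y} → 0# ≤ᶠ x → 0# ≤ᶠ y → 0# ≤ᶠ x + y
  sum-nonneg 0≤x 0≤y = O.≤-respˡ-≈ (+-identityʳ 0#) (+-mono₂-≤ 0≤x 0≤y)

  distSq-nonneg : ∀ {d} (u w : Vec Carrier d) → 0# ≤ᶠ distSq u w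
  distSq-nonneg []      []      = O.refl
  distSq-nonneg (a ∷ u) (b ∷ w) = sum-nonneg (square-nonneg (a - b)) (distSq-nonneg u w)

  -- a square that is at most 0 comes from 0 (up to double negation: F has
  -- no decidable equality)
  square≤0 : ∀ x → x * x ≤ᶠ 0# → ¬ ¬ (x ≈ 0#)
  square≤0 x x²≤0 x≉0 with inverse x x≉0
  ... | y , xy≈1 = nontrivial (begin
      1#                  ≈⟨ *-identityˡ 1# ⟨
      1# * 1#             ≈⟨ *-cong xy≈1 xy≈1 ⟨
      (x * y) * (x * y)   ≈⟨ solve 2 (λ x y → (x :* y) :* (x :* y) := (x :* x) :* (y :* y)) ≈-refl x y ⟩
      (x * x) * (y * y)   ≈⟨ *-congʳ (O.antisym x²≤0 (square-nonneg x)) ⟩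
      0# * (y * y)        ≈⟨ zeroˡ _ ⟩
      0#                  ∎)
    where open import Relation.Binary.Reasoning.Setoid setoid

  0≤1 : 0# ≤ᶠ 1#
  0≤1 = O.≤-respʳ-≈ (*-identityˡ 1#) (square-nonneg 1#)

  ℕ↑-nonneg : ∀ m → 0# ≤ᶠ ℕ↑ m
  ℕ↑-nonneg ℕ.zero    = O.refl
  ℕ↑-nonneg (ℕ.suc m) = sum-nonneg 0≤1 (ℕ↑-nonneg m)

  ℕ↑-suc≉0 : ∀ m → ¬ (ℕ↑ (ℕ.suc m) ≈ 0#)
  ℕ↑-suc≉0 m 1+m≈0 = nontrivial (O.antisym (O.≤-respʳ-≈ 1+m≈0 (x≤x+y (ℕ↑-nonneg m))) 0≤1)

  ℤ↑-zero : ∀ k → ℤ↑ k ≈ 0# → k ≡ + 0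
  ℤ↑-zero (+ ℕ.zero)    _     = refl
  ℤ↑-zero (+ ℕ.suc m)   1+m≈0 = ⊥-elim (ℕ↑-suc≉0 m 1+m≈0)
  ℤ↑-zero -[1+ m ]      -k≈0  =
    ⊥-elim (ℕ↑-suc≉0 m (≈-trans (≈-sym (⁻¹-involutive _)) (≈-trans (-‿cong -k≈0) ε⁻¹≈ε)))

  L : ∀ {n} → Vec Carrier n → Vec ℤ n → Carrier
  L row z = dot row (map ℤ↑ z)

  L-⊕ : ∀ {n} (row : Vec Carrier n) x y → L row (x ⊕ y) ≈ L row x + L row y
  L-⊕ []        []      []      = ≈-sym (+-identityˡ 0#)
  L-⊕ (r ∷ row) (a ∷ x) (b ∷ y) = ≈-trans
    (+-cong (*-congˡ (ℤ↑-+ a b)) (L-⊕ row x y))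
    (solve 5 (λ r a b u w → r :* (a :+ b) :+ (u :+ w) := (r :* a :+ u) :+ (r :* b :+ w))
           ≈-refl r (ℤ↑ a) (ℤ↑ b) (L row x) (L row y))

  L-⊖ : ∀ {n} (row : Vec Carrier n) x y → L row (x ⊖ y) ≈ L row x - L row y
  L-⊖ []        []      []      = ≈-sym (≈-trans (+-congˡ ε⁻¹≈ε) (+-identityʳ 0#))
  L-⊖ (r ∷ row) (a ∷ x) (b ∷ y) = ≈-trans
    (+-cong (*-congˡ (ℤ↑-- a b)) (L-⊖ row x y))
    (solve 5 (λ r a b u w → r :* (a :- b) :+ (u :- w) := (r :* a :+ u) :- (r :* b :+ w))
           ≈-refl r (ℤ↑ a) (ℤ↑ b) (L row x) (L row y))

  -- N B p q = ‖Bp − Bq‖².  If it is at most 0 then p = q, as every row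
  -- of B(p − q) vanishes and the columns of B are independent.
  N : ∀ {d n} → Vec (Vec Carrier n) d → Vec ℤ n → Vec ℤ n → Carrier
  N B p q = distSq (latticePt B p) (latticePt B q)

  rows-vanish : ∀ {d n} (B : Vec (Vec Carrier n) d) (p q : Vec ℤ n) → N B p q ≤ᶠ 0# →
    ¬ ¬ VecAll.All (_≈ 0#) (mulVec B (map ℤ↑ (p ⊖ q)))
  rows-vanish []        p q _    no-all = no-all []
  rows-vanish (row ∷ B) p q N≤0 no-all =
    square≤0 (L row p - L row q) row²≤0 λ row≈0 →
    rows-vanish B p q rest≤0 λ rest≈0 →
    no-all (≈-trans (L-⊖ row p q) row≈0 ∷ rest≈0)
    where
    row²≤0 : (L row p - L row q) * (L row p - L row q) ≤ᶠ 0#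
    row²≤0 = O.trans (x≤x+y (distSq-nonneg (latticePt B p) (latticePt B q))) N≤0
    rest≤0 : N B p q ≤ᶠ 0#
    rest≤0 = O.trans (O.≤-respʳ-≈ (+-comm _ _) (x≤x+y (square-nonneg (L row p - L row q)))) N≤0

  coordinates-vanish : ∀ {n} (p q : Vec ℤ n) → VecAll.All (_≈ 0#) (map ℤ↑ (p ⊖ q)) → p ≡ q
  coordinates-vanish []      []      []         = refl
  coordinates-vanish (a ∷ p) (b ∷ q) (a-b≈0 ∷ rest) =
    cong₂ _∷_ (ℤP.i-j≡0⇒i≡j a b (ℤ↑-zero _ a-b≈0)) (coordinates-vanish p q rest)

  null-distance⇒≡ : ∀ {d n} (B : Vec (Vec Carrier n) d) → LinIndepCols B →
    ∀ p q → N B p q ≤ᶠ 0# → p ≡ q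
  null-distance⇒≡ B independent p q N≤0 with VecP.≡-dec ℤ._≟_ p q
  ... | yes p≡q = p≡q
  ... | no  p≢q = ⊥-elim (rows-vanish B p q N≤0 λ Bpq≈0 →
                    p≢q (coordinates-vanish p q (independent _ Bpq≈0)))

  D : ∀ {d n} → Vec (Vec Carrier n) d → Vec Carrier d → Vec ℤ n → Carrier
  D B t z = distSq (latticePt B z) t

  sqd : Carrier → Carrier → Carrier
  sqd x s = (x - s) * (x - s)

  sqd-cong : ∀ {x y} s → x ≈ y → sqd x s ≈ sqd y s
  sqd-cong s x≈y = *-cong (+-congʳ x≈y) (+-congʳ x≈y)

  reflection-identity : ∀ a₁ a₂ a₃ w s →
    sqd (a₂ + a₃ - w) s + sqd (a₁ + a₃ - w) s + sqd (a₁ + a₂ - w) s + sqd w s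
      ≈ sqd a₁ s + sqd a₂ s + sqd a₃ s + sqd (a₁ + a₂ + a₃ - (w + w)) s
  reflection-identity = solve 5 (λ a₁ a₂ a₃ w s →
      (a₂ :+ a₃ :- w :- s) :* (a₂ :+ a₃ :- w :- s) :+ (a₁ :+ a₃ :- w :- s) :* (a₁ :+ a₃ :- w :- s)
        :+ (a₁ :+ a₂ :- w :- s) :* (a₁ :+ a₂ :- w :- s) :+ (w :- s) :* (w :- s)
      := (a₁ :- s) :* (a₁ :- s) :+ (a₂ :- s) :* (a₂ :- s) :+ (a₃ :- s) :* (a₃ :- s)
        :+ (a₁ :+ a₂ :+ a₃ :- (w :+ w) :- s) :* (a₁ :+ a₂ :+ a₃ :- (w :+ w) :- s)) ≈-refl

  interchange₄ : ∀ a₁ a₂ a₃ a₄ b₁ b₂ b₃ b₄ →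
    (a₁ + b₁) + (a₂ + b₂) + (a₃ + b₃) + (a₄ + b₄) ≈ (a₁ + a₂ + a₃ + a₄) + (b₁ + b₂ + b₃ + b₄)
  interchange₄ = solve 8 (λ a₁ a₂ a₃ a₄ b₁ b₂ b₃ b₄ →
    (a₁ :+ b₁) :+ (a₂ :+ b₂) :+ (a₃ :+ b₃) :+ (a₄ :+ b₄)
      := (a₁ :+ a₂ :+ a₃ :+ a₄) :+ (b₁ :+ b₂ :+ b₃ :+ b₄)) ≈-refl

  sum-of-reflections : ∀ {d n} (B : Vec (Vec Carrier n) d) t (z₁ z₂ z₃ v : Vec ℤ n) →
    D B t (z₂ ⊕ z₃ ⊖ v) + D B t (z₁ ⊕ z₃ ⊖ v) + D B t (z₁ ⊕ z₂ ⊖ v) + D B t v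
      ≈ D B t z₁ + D B t z₂ + D B t z₃ + D B t (z₁ ⊕ z₂ ⊕ z₃ ⊖ (v ⊕ v))
  sum-of-reflections []        []      z₁ z₂ z₃ v = ≈-refl
  sum-of-reflections {n = n} (row ∷ B) (s ∷ t) z₁ z₂ z₃ v = ≈-trans (interchange₄ _ _ _ _ _ _ _ _)
    (≈-trans (+-cong first-row (sum-of-reflections B t z₁ z₂ z₃ v))
             (≈-sym (interchange₄ _ _ _ _ _ _ _ _)))
    where
    a : Vec ℤ n → Carrier
    a = L row
    a-reflect : ∀ x y → a (x ⊕ y ⊖ v) ≈ a x + a y - a v
    a-reflect x y = ≈-trans (L-⊖ row (x ⊕ y) v) (+-congʳ (L-⊕ row x y))
    a-z₄ : a (z₁ ⊕ z₂ ⊕ z₃ ⊖ (v ⊕ v)) ≈ a z₁ + a z₂ + a z₃ - (a v + a v)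
    a-z₄ = ≈-trans (L-⊖ row _ _)
      (+-cong (≈-trans (L-⊕ row _ _) (+-congʳ (L-⊕ row _ _))) (-‿cong (L-⊕ row v v)))
    first-row : sqd (a (z₂ ⊕ z₃ ⊖ v)) s + sqd (a (z₁ ⊕ z₃ ⊖ v)) s + sqd (a (z₁ ⊕ z₂ ⊖ v)) s + sqd (a v) s
      ≈ sqd (a z₁) s + sqd (a z₂) s + sqd (a z₃) s + sqd (a (z₁ ⊕ z₂ ⊕ z₃ ⊖ (v ⊕ v))) s
    first-row = ≈-trans
      (+-congʳ (+-cong (+-cong (sqd-cong s (a-reflect z₂ z₃)) (sqd-cong s (a-reflect z₁ z₃)))
                       (sqd-cong s (a-reflect z₁ z₂))))
      (≈-trans (reflection-identity (a z₁) (a z₂) (a z₃) (a v) s)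
               (+-congˡ (sqd-cong s (≈-sym a-z₄))))

  parallelogram-law : ∀ {d n} (B : Vec (Vec Carrier n) d) t (p q r : Vec ℤ n) → r ⊕ q ≡ p ⊕ p →
    D B t r + D B t q ≈ (D B t p + D B t p) + (N B p q + N B p q)
  parallelogram-law []        []      p q r _ =
    ≈-trans (≈-sym (+-identityʳ _)) (+-congˡ (≈-sym (+-identityʳ 0#)))
  parallelogram-law {n = n} (row ∷ B) (s ∷ t) p q r r+q≡2p = ≈-trans (interchange₂ _ _ _ _)
    (≈-trans (+-cong first-row (parallelogram-law B t p q r r+q≡2p)) (regroup _ _ _ _))
    where
    a : Vec ℤ n → Carrier
    a = L row
    δ : Carrier
    δ = a p - a q
    interchange₂ : ∀ x₁ y₁ x₂ y₂ → (x₁ + y₁) + (x₂ + y₂) ≈ (x₁ + x₂) + (y₁ + y₂)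
    interchange₂ = solve 4 (λ x₁ y₁ x₂ y₂ → (x₁ :+ y₁) :+ (x₂ :+ y₂) := (x₁ :+ x₂) :+ (y₁ :+ y₂)) ≈-refl
    regroup : ∀ x y u w → ((x + x) + (u + u)) + ((y + y) + (w + w)) ≈ ((x + y) + (x + y)) + ((u + w) + (u + w))
    regroup = solve 4 (λ x y u w → ((x :+ x) :+ (u :+ u)) :+ ((y :+ y) :+ (w :+ w))
                                    := ((x :+ y) :+ (x :+ y)) :+ ((u :+ w) :+ (u :+ w))) ≈-refl
    a-r : a r ≈ (a p + a p) - a q
    a-r = ≈-trans (solve 2 (λ x y → x := (x :+ y) :- y) ≈-refl (a r) (a q))
      (+-congʳ (≈-trans (≈-sym (L-⊕ row r q)) (≈-trans (reflexive (cong a r+q≡2p)) (L-⊕ row p p))))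
    first-row : sqd (a r) s + sqd (a q) s ≈ (sqd (a p) s + sqd (a p) s) + (δ * δ + δ * δ)
    first-row = ≈-trans (+-congʳ (sqd-cong s a-r))
      (solve 3 (λ x y s → ((x :+ x) :- y :- s) :* ((x :+ x) :- y :- s) :+ (y :- s) :* (y :- s)
                 := ((x :- s) :* (x :- s) :+ (x :- s) :* (x :- s)) :+ ((x :- y) :* (x :- y) :+ (x :- y) :* (x :- y)))
             ≈-refl (a p) (a q) s)

  -- Strict convexity: if q and r = 2p − q are closest vectors, then p = q.
  -- Indeed 2μ + 2‖B(p − q)‖² = D r + D q ≤ 2μ for μ = D p.
  midpoint-closest : ∀ {d n} (B : Vec (Vec Carrier n) d) → LinIndepCols B → ∀ t (p q r : Vec ℤ n) →
    r ⊕ q ≡ p ⊕ p → InCVP t B q → InCVP t B r → p ≡ q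
  midpoint-closest B independent t p q r r+q≡2p closest-q closest-r =
    null-distance⇒≡ B independent p q
      (O.trans (x≤x+y (distSq-nonneg (latticePt B p) (latticePt B q))) 2N≤0)
    where
    μ : Carrier
    μ = D B t p
    2N≤0 : N B p q + N B p q ≤ᶠ 0#
    2N≤0 = +-cancelˡ-≤ (μ + μ)
      (O.≤-respˡ-≈ (parallelogram-law B t p q r r+q≡2p)
        (O.≤-respʳ-≈ (≈-sym (+-identityʳ _)) (+-mono₂-≤ (closest-r p) (closest-q p))))

  ≤-first-of-four : ∀ {x₁ x₂ x₃ x₄ μ} → x₁ + x₂ + x₃ + x₄ ≤ᶠ μ + μ + μ + μ →
    μ ≤ᶠ x₂ → μ ≤ᶠ x₃ → μ ≤ᶠ x₄ → x₁ ≤ᶠ μ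
  ≤-first-of-four {x₁} {μ = μ} sum≤4μ μ≤x₂ μ≤x₃ μ≤x₄ =
    +-cancelʳ-≤ μ (+-cancelʳ-≤ μ (+-cancelʳ-≤ μ
      (O.trans (+-mono₂-≤ (+-mono₂-≤ (+-monoʳ-≤ x₁ μ≤x₂) μ≤x₃) μ≤x₄) sum≤4μ)))

  rotate₄ : ∀ x₁ x₂ x₃ x₄ → x₂ + x₃ + x₄ + x₁ ≈ x₁ + x₂ + x₃ + x₄
  rotate₄ = solve 4 (λ x₁ x₂ x₃ x₄ → x₂ :+ x₃ :+ x₄ :+ x₁ := x₁ :+ x₂ :+ x₃ :+ x₄) ≈-refl

  -- First claim of the lemma: the reflected points are closest vectors.
  -- Their distances sum to that of z₁ z₂ z₃ z₄, at most 4μ with μ = D z₁,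
  -- while each is at least μ; so each is at most μ.
  reflections-closest : ∀ {d n} (B : Vec (Vec Carrier n) d) t (z₁ z₂ z₃ v : Vec ℤ n) →
    InCVP t B z₁ → InCVP t B z₂ → InCVP t B z₃ → InCVP t B (z₁ ⊕ z₂ ⊕ z₃ ⊖ (v ⊕ v)) →
    InCVP t B (z₂ ⊕ z₃ ⊖ v) × InCVP t B (z₁ ⊕ z₃ ⊖ v) × InCVP t B (z₁ ⊕ z₂ ⊖ v) × InCVP t B v
  reflections-closest B t z₁ z₂ z₃ v c₁ c₂ c₃ c₄ =
      closest (≤-first-of-four total≤4μ (c₁ _) (c₁ _) (c₁ _))
    , closest (≤-first-of-four (rotated total≤4μ) (c₁ _) (c₁ _) (c₁ _))
    , closest (≤-first-of-four (rotated (rotated total≤4μ)) (c₁ _) (c₁ _) (c₁ _))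
    , closest (≤-first-of-four (rotated (rotated (rotated total≤4μ))) (c₁ _) (c₁ _) (c₁ _))
    where
    μ : Carrier
    μ = D B t z₁
    closest : ∀ {z} → D B t z ≤ᶠ μ → InCVP t B z
    closest z≤μ y = O.trans z≤μ (c₁ y)
    rotated : ∀ {x₁ x₂ x₃ x₄} → x₁ + x₂ + x₃ + x₄ ≤ᶠ μ + μ + μ + μ → x₂ + x₃ + x₄ + x₁ ≤ᶠ μ + μ + μ + μ
    rotated = O.≤-respˡ-≈ (≈-sym (rotate₄ _ _ _ _))
    total≤4μ : D B t (z₂ ⊕ z₃ ⊖ v) + D B t (z₁ ⊕ z₃ ⊖ v) + D B t (z₁ ⊕ z₂ ⊖ v) + D B t v
               ≤ᶠ μ + μ + μ + μ
    total≤4μ = O.≤-respˡ-≈ (≈-sym (sum-of-reflections B t z₁ z₂ z₃ v))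
      (+-mono₂-≤ (+-mono₂-≤ (+-mono₂-≤ O.refl (c₂ z₁)) (c₃ z₁)) (c₄ z₁))

  -- zᵢ differs from its reflection zᵢ′, and z₄ from v: each coincidence
  -- would make one of z₁ z₂ z₃ v the midpoint of two distinct closest
  -- vectors.
  reflections-distinct : ∀ {d n} (B : Vec (Vec Carrier n) d) → LinIndepCols B → ∀ t (z₁ z₂ z₃ v : Vec ℤ n) →
    let open Configuration z₁ z₂ z₃ v in
    InCVP t B z₁ → InCVP t B z₂ → InCVP t B (pt Z₁′) → InCVP t B (pt Z₂′) →
    z₁ ≢ z₂ → z₁ ≢ z₃ → z₁ ≢ pt Z₄ →
    z₁ ≢ pt Z₁′ × z₂ ≢ pt Z₂′ × z₃ ≢ pt Z₃′ × pt Z₄ ≢ v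
  reflections-distinct {n = n} B independent t z₁ z₂ z₃ v c₁ c₂ c₁′ c₂′ z₁≢z₂ z₁≢z₃ z₁≢z₄ =
      (λ z₁≡z₁′ → z₁≢z₂ (midpoint t z₁ z₂ _
         (transfer Z₁′ Z₁ (Z₂′ ⊞ Z₂) (Z₁ ⊞ Z₁) (sym z₁≡z₁′)) c₂ c₂′))
    , (λ z₂≡z₂′ → z₁≢z₂ (sym (midpoint t z₂ z₁ _
         (transfer Z₂′ Z₂ (Z₁′ ⊞ Z₁) (Z₂ ⊞ Z₂) (sym z₂≡z₂′)) c₁ c₁′)))
    , (λ z₃≡z₃′ → z₁≢z₃ (sym (midpoint t z₃ z₁ _
         (transfer Z₃′ Z₃ (Z₁′ ⊞ Z₁) (Z₃ ⊞ Z₃) (sym z₃≡z₃′)) c₁ c₁′)))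
    , (λ z₄≡v → z₁≢z₄ (sym (trans z₄≡v (midpoint t v z₁ _
         (transfer Z₄ V (Z₁′ ⊞ Z₁) (V ⊞ V) z₄≡v) c₁ c₁′))))
    where
    open Configuration z₁ z₂ z₃ v
    open LinearIdentities using (Z₁; Z₂; Z₃; V; _⊞_)
    midpoint : ∀ t (p q r : Vec ℤ n) → r ⊕ q ≡ p ⊕ p → InCVP t B q → InCVP t B r → p ≡ q
    midpoint = midpoint-closest B independent

lemma6p8 : ∀ {c ℓ₁ ℓ₂ : Level} (F : CompleteOrderedField c ℓ₁ ℓ₂) →
    let open CompleteOrderedField F using (Carrier) in
    let open LatticeDefs F in
    ∀ (d n : ℕ) → 2 ≤ n →
    (B : Vec (Vec Carrier n) d) → LinIndepCols B →
    (t : Vec Carrier d) →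
    (z₁ z₂ z₃ v : Vec ℤ n) →
    let z₄ = z₁ ⊕ z₂ ⊕ z₃ ⊖ (v ⊕ v) in
    InCVP t B z₁ → InCVP t B z₂ → InCVP t B z₃ → InCVP t B z₄ →
    z₁ ≢ z₂ → z₁ ≢ z₃ → z₁ ≢ z₄ → z₂ ≢ z₃ → z₂ ≢ z₄ → z₃ ≢ z₄ →
    let z₁′ = z₂ ⊕ z₃ ⊖ v in
    let z₂′ = z₁ ⊕ z₃ ⊖ v in
    let z₃′ = z₁ ⊕ z₂ ⊖ v in
    let z₄′ = v in
    let C = z₁ ∷ z₂ ∷ z₃ ∷ z₄ ∷ z₁′ ∷ z₂′ ∷ z₃′ ∷ z₄′ ∷ [] in
    (InCVP t B z₁′ × InCVP t B z₂′ × InCVP t B z₃′ × InCVP t B z₄′)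
    × (HasSize C 4 ⊎ HasSize C 8)
    × (HasSize C 4 ⇔
        Σ (Vec ℤ n) λ y₀ → Σ (Vec ℤ n) λ y₁ → Σ (Vec ℤ n) λ y₂ →
          SameSet C (y₀ ∷ y₀ ⊕ y₁ ∷ y₀ ⊕ y₂ ∷ y₀ ⊕ y₁ ⊕ y₂ ∷ []))
lemma6p8 F d n _ B independent t z₁ z₂ z₃ v c₁ c₂ c₃ c₄ z₁≢z₂ z₁≢z₃ z₁≢z₄ z₂≢z₃ z₂≢z₄ z₃≢z₄ =
  let open Geometry F
      c₁′ , c₂′ , c₃′ , cᵥ = reflections-closest B t z₁ z₂ z₃ v c₁ c₂ c₃ c₄
      z₁≢z₁′ , z₂≢z₂′ , z₃≢z₃′ , z₄≢v =
        reflections-distinct B independent t z₁ z₂ z₃ v c₁ c₂ c₁′ c₂′ z₁≢z₂ z₁≢z₃ z₁≢z₄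
  in (c₁′ , c₂′ , c₃′ , cᵥ)
   , Configuration.size-of-C z₁ z₂ z₃ v
       z₁≢z₂ z₁≢z₃ z₁≢z₄ z₂≢z₃ z₂≢z₄ z₃≢z₄ z₁≢z₁′ z₂≢z₂′ z₃≢z₃′ z₄≢v
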